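{- If $N:\langle\Gamma\vdash U\rangle$ and $M\rhd_\beta N$ (one step), then $M:\langle\Gamma{\uparrow^{M}}\vdash U\rangle$.
   Context: Terms: $\mathcal V$ is a denumerably infinite set of variables; $\mathcal M$ is the set of untyped $\lambda$-terms $M::=x\mid \lambda x.M\mid MM$ taken modulo $\alpha$-conversion; $FV(M)$ is the set of free variables; $M[x:=N]$ is capture-avoiding substitution. $\rhd_\beta$ is the compatible closure of $(\lambda x.M)N\rhd_\beta M[x:=N]$. Types: $\mathcal A$ is a denumerably infinite set of atomic types; $\mathbb T::=a\mid \mathbb U\to\mathbb T$ ($a\in\mathcal A$) and $\mathbb U::=\omega\mid \mathbb U\sqcap\mathbb U\mid \mathbb T$; types are quotiented by commutativity, associativity and idempotence of $\sqcap$ and by $\omega\sqcap U=U$. $T$ ranges over $\mathbb T$, $U,V$ over $\mathbb U$. Environments: a type environment is a finite set $(x_i:U_i)_n$ of declarations with pairwise distinct variables; $dom$ is its set of variables; $\Gamma,x:U$ requires $x\notin dom(\Gamma)$; $env^M_\omega$ assigns $\omega$ to each variable of $FV(M)$ and nothing else; if $\Gamma_1=(x_i:U_i)_n,(y_j:V_j)_m$ and $\Gamma_2=(x_i:U'_i)_n,(z_k:W_k)_l$ with the $y_j$, $z_k$ all distinct, then $\Gamma_1\sqcap\Gamma_2=(x_i:U_i\sqcap U'_i)_n,(y_j:V_j)_m,(z_k:W_k)_l$. If $\Gamma=(x_i:U_i)_n$ and $\mathcal U=\{x_1,\dots,x_m\}$ with $m\ge n$, then $\Gamma{\uparrow^{\mathcal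 U}}=x_1:U_1,\dots,x_n:U_n,x_{n+1}:\omega,\dots,x_m:\omega$; when $dom(\Gamma)\subseteq FV(M)$, $\Gamma{\uparrow^M}$ means $\Gamma{\uparrow^{FV(M)}}$. Subtyping: $\sqsubseteq$ (on types, on environments, and on typings $\langle\Gamma\vdash U\rangle$) is the least relation closed under: $\Phi\sqsubseteq\Phi$; transitivity; $U_1\sqcap U_2\sqsubseteq U_1$; if $U_1\sqsubseteq V_1$ and $U_2\sqsubseteq V_2$ then $U_1\sqcap U_2\sqsubseteq V_1\sqcap V_2$; if $U_2\sqsubseteq U_1$ and $T_1\sqsubseteq T_2$ then $U_1\to T_1\sqsubseteq U_2\to T_2$; if $U_1\sqsubseteq U_2$ and $x\notin dom(\Gamma)$ then $\Gamma,x:U_1\sqsubseteq\Gamma,x:U_2$; if $U_1\sqsubseteq U_2$ and $\Gamma_2\sqsubseteq\Gamma_1$ then $\langle\Gamma_1\vdash U_1\rangle\sqsubseteq\langle\Gamma_2\vdash U_2\rangle$. Typing rules for $M:\langle\Gamma\vdash U\rangle$: (ax) $x:\langle x:T\vdash T\rangle$ for $T\in\mathbb T$; ($\omega$) $M:\langle env^M_\omega\vdash\omega\rangle$; ($\to_i$) from $M:\langle\Gamma,x:U\vdash T\rangle$ infer $\lambda x.M:\langle\Gamma\vdash U\to T\rangle$; ($\to'_i$) from $M:\langle\Gamma\vdash T\rangle$ and $x\notin dom(\Gamma)$ infer $\lambda x.M:\langle\Gamma\vdash\omega\to T\rangle$; ($\to_e$) from $M_1:\langle\Gamma_1\vdash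 U\to T\rangle$ and $M_2:\langle\Gamma_2\vdash U\rangle$ infer $M_1M_2:\langle\Gamma_1\sqcap\Gamma_2\vdash T\rangle$; ($\sqcap_i$) from $M:\langle\Gamma\vdash U_1\rangle$ and $M:\langle\Gamma\vdash U_2\rangle$ infer $M:\langle\Gamma\vdash U_1\sqcap U_2\rangle$; ($\sqsubseteq$) from $M:\langle\Gamma\vdash U\rangle$ and $\langle\Gamma\vdash U\rangle\sqsubseteq\langle\Gamma'\vdash U'\rangle$ infer $M:\langle\Gamma'\vdash U'\rangle$. -}

module Defs where

open import Data.Nat using (ℕ; zero; suc; _≡ᵇ_)
open import Data.Bool using (Bool; true; false; if_then_else_; _∨_)
open import Data.Maybe using (Maybe; just; nothing)
open import Data.Maybe.Relation.Binary.Pointwise using (Pointwise)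

-- Untyped λ-terms modulo α-conversion: de Bruijn indices.

data Tm : Set where
  var : ℕ → Tm
  lam : Tm → Tm
  app : Tm → Tm → Tm

ext : (ℕ → ℕ) → ℕ → ℕ
ext ρ zero    = zero
ext ρ (suc i) = suc (ρ i)

rename : (ℕ → ℕ) → Tm → Tm
rename ρ (var i)   = var (ρ i)
rename ρ (lam M)   = lam (rename (ext ρ) M)
rename ρ (app M N) = app (rename ρ M) (rename ρ N)

exts : (ℕ → Tm) → ℕ → Tm
exts σ zero    = var zero
exts σ (suc i) = rename suc (σ i)

subst : (ℕ → Tm) → Tm → Tm
subst σ (var i)   = σ i
subst σ (lam M)   = lam (subst (exts σ) M)
subst σ (app M N) = app (subst σ M) (subst σ N)

single : Tm → ℕ → Tm
single N zero    = N
single N (suc i) = var i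

_[_] : Tm → Tm → Tm
M [ N ] = subst (single N) M

infix 4 _▷β_
data _▷β_ : Tm → Tm → Set where
  β    : ∀ {M N} → app (lam M) N ▷β M [ N ]
  ξlam : ∀ {M M'} → M ▷β M' → lam M ▷β lam M'
  ξappL : ∀ {M M' N} → M ▷β M' → app M N ▷β app M' N
  ξappR : ∀ {M N N'} → N ▷β N' → app M N ▷β app M N'

freeIn : ℕ → Tm → Bool
freeIn i (var j)   = i ≡ᵇ j
freeIn i (lam M)   = freeIn (suc i) M
freeIn i (app M N) = freeIn i M ∨ freeIn i N

-- Types (syntactic; the quotient by ACI of ⊓ and ω-unit is built into ≤)

infixr 7 _⇒_
infixl 6 _⊓_

mutual
  data STy : Set where
    at  : ℕ → STy
    _⇒_ : ITy → STy → STy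

  data ITy : Set where
    ω   : ITy
    _⊓_ : ITy → ITy → ITy
    ⌜_⌝ : STy → ITy

infix 4 _≤_
data _≤_ : ITy → ITy → Set where
  refl  : ∀ {U} → U ≤ U
  trans : ∀ {U V W} → U ≤ V → V ≤ W → U ≤ W
  ⊓-l   : ∀ {U₁ U₂} → U₁ ⊓ U₂ ≤ U₁
  ⊓-mono : ∀ {U₁ U₂ V₁ V₂} → U₁ ≤ V₁ → U₂ ≤ V₂ → U₁ ⊓ U₂ ≤ V₁ ⊓ V₂
  ⇒-mono : ∀ {U₁ U₂ T₁ T₂} → U₂ ≤ U₁ → ⌜ T₁ ⌝ ≤ ⌜ T₂ ⌝ → ⌜ U₁ ⇒ T₁ ⌝ ≤ ⌜ U₂ ⇒ T₂ ⌝
  ⊓-comm    : ∀ {U V} → U ⊓ V ≤ V ⊓ U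
  ⊓-assoc   : ∀ {U V W} → (U ⊓ V) ⊓ W ≤ U ⊓ (V ⊓ W)
  ⊓-assoc⁻¹ : ∀ {U V W} → U ⊓ (V ⊓ W) ≤ (U ⊓ V) ⊓ W
  ⊓-idem    : ∀ {U} → U ≤ U ⊓ U
  ⊓-idem⁻¹  : ∀ {U} → U ⊓ U ≤ U
  ω-unit    : ∀ {U} → ω ⊓ U ≤ U
  ω-unit⁻¹  : ∀ {U} → U ≤ ω ⊓ U

Env : Set
Env = ℕ → Maybe ITy

∅ : Env
∅ _ = nothing

infixr 5 _∷ₑ_
_∷ₑ_ : Maybe ITy → Env → Env
(m ∷ₑ Γ) zero    = m
(m ∷ₑ Γ) (suc i) = Γ i

_↦_ : ℕ → STy → Env
(x ↦ T) i = if i ≡ᵇ x then just ⌜ T ⌝ else nothing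

envω : Tm → Env
envω M i = if freeIn i M then just ω else nothing

_⊓ₘ_ : Maybe ITy → Maybe ITy → Maybe ITy
just U  ⊓ₘ just V  = just (U ⊓ V)
just U  ⊓ₘ nothing = just U
nothing ⊓ₘ m       = m

_⊓ₑ_ : Env → Env → Env
(Γ₁ ⊓ₑ Γ₂) i = Γ₁ i ⊓ₘ Γ₂ i

_↑_ : Env → Tm → Env
(Γ ↑ M) i with Γ i
... | just U  = just U
... | nothing = if freeIn i M then just ω else nothing

infix 4 _≤ₑ_
_≤ₑ_ : Env → Env → Set
Γ ≤ₑ Γ' = ∀ i → Pointwise _≤_ (Γ i) (Γ' i)

infix 3 _∶⟨_⊢_⟩
data _∶⟨_⊢_⟩ : Tm → Env → ITy → Set where
  ax   : ∀ {x T} → var x ∶⟨ x ↦ T ⊢ ⌜ T ⌝ ⟩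
  ω-i  : ∀ {M} → M ∶⟨ envω M ⊢ ω ⟩
  ⇒-i  : ∀ {M Γ U T} → M ∶⟨ just U ∷ₑ Γ ⊢ ⌜ T ⌝ ⟩ → lam M ∶⟨ Γ ⊢ ⌜ U ⇒ T ⌝ ⟩
  ⇒-i' : ∀ {M Γ T} → M ∶⟨ nothing ∷ₑ Γ ⊢ ⌜ T ⌝ ⟩ → lam M ∶⟨ Γ ⊢ ⌜ ω ⇒ T ⌝ ⟩
  ⇒-e  : ∀ {M₁ M₂ Γ₁ Γ₂ U T} → M₁ ∶⟨ Γ₁ ⊢ ⌜ U ⇒ T ⌝ ⟩ → M₂ ∶⟨ Γ₂ ⊢ U ⟩
       → app M₁ M₂ ∶⟨ Γ₁ ⊓ₑ Γ₂ ⊢ ⌜ T ⌝ ⟩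
  ⊓-i  : ∀ {M Γ U₁ U₂} → M ∶⟨ Γ ⊢ U₁ ⟩ → M ∶⟨ Γ ⊢ U₂ ⟩ → M ∶⟨ Γ ⊢ U₁ ⊓ U₂ ⟩
  sub  : ∀ {M Γ U Γ' U'} → M ∶⟨ Γ ⊢ U ⟩ → U ≤ U' → Γ' ≤ₑ Γ → M ∶⟨ Γ' ⊢ U' ⟩

module Submission where

-- Two invariants of the type system drive the proof.  First, a derivable typing
-- declares exactly the free variables of its subject (`domain`); hence a typed
-- term is also typed under Γ↑M (`typed-↑`), and an ω-typing is available for any
-- term with more free variables (`ω-expansion`).  Second, typings of a
-- substitution instance can be split (`subst-inversion`): if M[x:=N] : ⟨Γ ⊢ U⟩,
-- then M : ⟨Δ ⊢ U⟩ and Γ ⊑ (Δ without x) ⊓ Θ, where either x ∉ dom(Δ) and Θ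
-- is empty, or Δ declares x : V and N : ⟨Θ ⊢ V⟩.  The inversion is proved for a substitution under k
-- binders, so that it passes through λ.

open import Data.Bool using (Bool; true; false; _∨_; _∧_; if_then_else_)
open import Data.Bool.Properties using (∨-identityʳ; ∨-zeroʳ; ∧-zeroʳ)
open import Data.Bool.Solver using (module ∨-∧-Solver)
open import Data.Empty using (⊥-elim)
open import Data.Maybe using (Maybe; just; nothing)
open import Data.Maybe.Relation.Binary.Pointwise using (Pointwise; just; nothing)
import Data.Maybe.Relation.Binary.Pointwise as Pointwise
open import Data.Nat using (ℕ; zero; suc; _≡ᵇ_; _≟_)
open import Data.Nat.Properties using (suc-injective)
open import Data.Product using (Σ-syntax; _×_; _,_)
open import Function.Definitions using (Injective)
open import Level using (0ℓ)
open import Relation.Binary.Bundles using (Preorder)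
open import Relation.Binary.Structures using (IsPreorder)
import Relation.Binary.Reasoning.Preorder as PreorderReasoning
open import Relation.Nullary using (¬_; yes; no)
open import Relation.Binary.PropositionalEquality
  using (_≡_; refl; sym; cong; cong₂; _≗_; isEquivalence; module ≡-Reasoning)
  renaming (trans to ≡-trans; subst to ≡-subst)
open import Defs

⊓-r : ∀ {U V} → U ⊓ V ≤ V
⊓-r = trans ⊓-comm ⊓-l

⊓-glb : ∀ {W U V} → W ≤ U → W ≤ V → W ≤ U ⊓ V
⊓-glb p q = trans ⊓-idem (⊓-mono p q)

≤-ω : ∀ {U} → U ≤ ω
≤-ω = trans ω-unit⁻¹ ⊓-l

infix 4 _≤ₘ_
_≤ₘ_ : Maybe ITy → Maybe ITy → Set
_≤ₘ_ = Pointwise _≤_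

≤ₘ-reflexive : ∀ {a b} → a ≡ b → a ≤ₘ b
≤ₘ-reflexive refl = Pointwise.refl refl

≤ₘ-isPreorder : IsPreorder _≡_ _≤ₘ_
≤ₘ-isPreorder = record
  { isEquivalence = isEquivalence
  ; reflexive     = ≤ₘ-reflexive
  ; trans         = Pointwise.trans trans
  }

≤ₘ-preorder : Preorder 0ℓ 0ℓ 0ℓ
≤ₘ-preorder = record { isPreorder = ≤ₘ-isPreorder }

open IsPreorder ≤ₘ-isPreorder using () renaming (refl to ≤ₘ-refl; trans to ≤ₘ-trans)
module ≤ₘ-Reasoning = PreorderReasoning ≤ₘ-preorder

≤ₘ-just : ∀ {m V} → m ≤ₘ just V → Σ[ U ∈ ITy ] m ≡ just U × U ≤ V
≤ₘ-just (just p) = _ , refl , p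

⊓ₘ-identityʳ : ∀ m → m ⊓ₘ nothing ≡ m
⊓ₘ-identityʳ (just _) = refl
⊓ₘ-identityʳ nothing  = refl

⊓ₘ-mono : ∀ {a b c d} → a ≤ₘ b → c ≤ₘ d → a ⊓ₘ c ≤ₘ b ⊓ₘ d
⊓ₘ-mono (just p) (just q) = just (⊓-mono p q)
⊓ₘ-mono (just p) nothing  = just p
⊓ₘ-mono nothing  q        = q

⊓ₘ-monoʳ : ∀ a {c d} → c ≤ₘ d → a ⊓ₘ c ≤ₘ a ⊓ₘ d
⊓ₘ-monoʳ a = ⊓ₘ-mono (≤ₘ-refl {a})

⊓ₘ-monoˡ : ∀ {a b} c → a ≤ₘ b → a ⊓ₘ c ≤ₘ b ⊓ₘ c
⊓ₘ-monoˡ c p = ⊓ₘ-mono p (≤ₘ-refl {c})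

⊓ₘ-comm : ∀ a b → a ⊓ₘ b ≤ₘ b ⊓ₘ a
⊓ₘ-comm (just _) (just _) = just ⊓-comm
⊓ₘ-comm (just _) nothing  = ≤ₘ-refl
⊓ₘ-comm nothing  (just _) = ≤ₘ-refl
⊓ₘ-comm nothing  nothing  = ≤ₘ-refl

⊓ₘ-assoc : ∀ a b c → (a ⊓ₘ b) ⊓ₘ c ≤ₘ a ⊓ₘ (b ⊓ₘ c)
⊓ₘ-assoc (just _) (just _) (just _) = just ⊓-assoc
⊓ₘ-assoc (just _) (just _) nothing  = ≤ₘ-refl
⊓ₘ-assoc (just _) nothing  _        = ≤ₘ-refl
⊓ₘ-assoc nothing  _        _        = ≤ₘ-refl

⊓ₘ-assoc⁻¹ : ∀ a b c → a ⊓ₘ (b ⊓ₘ c) ≤ₘ (a ⊓ₘ b) ⊓ₘ c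
⊓ₘ-assoc⁻¹ (just _) (just _) (just _) = just ⊓-assoc⁻¹
⊓ₘ-assoc⁻¹ (just _) (just _) nothing  = ≤ₘ-refl
⊓ₘ-assoc⁻¹ (just _) nothing  _        = ≤ₘ-refl
⊓ₘ-assoc⁻¹ nothing  _        _        = ≤ₘ-refl

⊓ₘ-idem : ∀ m → m ≤ₘ m ⊓ₘ m
⊓ₘ-idem (just _) = just ⊓-idem
⊓ₘ-idem nothing  = nothing

⊓ₘ-interchange : ∀ a b c d → (a ⊓ₘ b) ⊓ₘ (c ⊓ₘ d) ≤ₘ (a ⊓ₘ c) ⊓ₘ (b ⊓ₘ d)
⊓ₘ-interchange a b c d = begin
  (a ⊓ₘ b) ⊓ₘ (c ⊓ₘ d)  ≲⟨ ⊓ₘ-assoc a b (c ⊓ₘ d) ⟩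
  a ⊓ₘ (b ⊓ₘ (c ⊓ₘ d))  ≲⟨ ⊓ₘ-monoʳ a (⊓ₘ-assoc⁻¹ b c d) ⟩
  a ⊓ₘ ((b ⊓ₘ c) ⊓ₘ d)  ≲⟨ ⊓ₘ-monoʳ a (⊓ₘ-monoˡ d (⊓ₘ-comm b c)) ⟩
  a ⊓ₘ ((c ⊓ₘ b) ⊓ₘ d)  ≲⟨ ⊓ₘ-monoʳ a (⊓ₘ-assoc c b d) ⟩
  a ⊓ₘ (c ⊓ₘ (b ⊓ₘ d))  ≲⟨ ⊓ₘ-assoc⁻¹ a c (b ⊓ₘ d) ⟩
  (a ⊓ₘ c) ⊓ₘ (b ⊓ₘ d)  ∎
  where open ≤ₘ-Reasoning

declared : Maybe ITy → Bool
declared (just _) = true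
declared nothing  = false

undeclared : ∀ {m} → declared m ≡ false → m ≡ nothing
undeclared {nothing} _ = refl

declared-⊓ₘ : ∀ a b → declared (a ⊓ₘ b) ≡ declared a ∨ declared b
declared-⊓ₘ (just _) (just _) = refl
declared-⊓ₘ (just _) nothing  = refl
declared-⊓ₘ nothing  _        = refl

declared-≤ₘ : ∀ {a b} → a ≤ₘ b → declared a ≡ declared b
declared-≤ₘ (just _) = refl
declared-≤ₘ nothing  = refl

⊓ₘ-lowerˡ : ∀ a b → declared a ≡ declared b → a ⊓ₘ b ≤ₘ a
⊓ₘ-lowerˡ (just _) (just _) _ = just ⊓-l
⊓ₘ-lowerˡ nothing  nothing  _ = nothing

⊓ₘ-lowerʳ : ∀ a b → declared a ≡ declared b → a ⊓ₘ b ≤ₘ b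
⊓ₘ-lowerʳ (just _) (just _) _ = just ⊓-r
⊓ₘ-lowerʳ nothing  nothing  _ = nothing

declareIf : ITy → Bool → Maybe ITy
declareIf U b = if b then just U else nothing

declared-declareIf : ∀ U b → declared (declareIf U b) ≡ b
declared-declareIf U true  = refl
declared-declareIf U false = refl

declareIf-mono : ∀ {U V} b → U ≤ V → declareIf U b ≤ₘ declareIf V b
declareIf-mono true  le = just le
declareIf-mono false le = nothing

declareIf-∨ : ∀ a b → declareIf ω (a ∨ b) ≤ₘ declareIf ω a ⊓ₘ declareIf ω b
declareIf-∨ true  true  = just ⊓-idem
declareIf-∨ true  false = ≤ₘ-refl
declareIf-∨ false _     = ≤ₘ-refl

≤ₑ-refl : ∀ {Γ} → Γ ≤ₑ Γ
≤ₑ-refl i = ≤ₘ-refl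

≤ₑ-trans : ∀ {Γ Δ Θ} → Γ ≤ₑ Δ → Δ ≤ₑ Θ → Γ ≤ₑ Θ
≤ₑ-trans p q i = ≤ₘ-trans (p i) (q i)

≗⇒≤ₑ : ∀ {Γ Δ} → Γ ≗ Δ → Γ ≤ₑ Δ
≗⇒≤ₑ e i = ≤ₘ-reflexive (e i)

tail : Env → Env
tail Γ i = Γ (suc i)

∷ₑ-tail : ∀ {Δ m} → Δ zero ≡ m → (m ∷ₑ tail Δ) ≗ Δ
∷ₑ-tail e zero    = sym e
∷ₑ-tail e (suc i) = refl

decl : ℕ → ITy → Env
decl x U i = declareIf U (i ≡ᵇ x)

≡ᵇ-refl : ∀ n → (n ≡ᵇ n) ≡ true
≡ᵇ-refl zero    = refl
≡ᵇ-refl (suc n) = ≡ᵇ-refl n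

≡ᵇ-≢ : ∀ {m n} → ¬ m ≡ n → (m ≡ᵇ n) ≡ false
≡ᵇ-≢ {zero}  {zero}  m≢n = ⊥-elim (m≢n refl)
≡ᵇ-≢ {zero}  {suc n} m≢n = refl
≡ᵇ-≢ {suc m} {zero}  m≢n = refl
≡ᵇ-≢ {suc m} {suc n} m≢n = ≡ᵇ-≢ (λ e → m≢n (cong suc e))

≡ᵇ-injective : ∀ {ρ : ℕ → ℕ} → Injective _≡_ _≡_ ρ → ∀ i j → (ρ i ≡ᵇ ρ j) ≡ (i ≡ᵇ j)
≡ᵇ-injective {ρ} inj i j with i ≟ j
... | yes refl = ≡-trans (≡ᵇ-refl (ρ i)) (sym (≡ᵇ-refl i))
... | no i≢j   = ≡-trans (≡ᵇ-≢ (λ e → i≢j (inj e))) (sym (≡ᵇ-≢ i≢j))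

∨-monoˡ-true : ∀ {a a' b} → (a ≡ true → a' ≡ true) → a ∨ b ≡ true → a' ∨ b ≡ true
∨-monoˡ-true {true}       h _ rewrite h refl = refl
∨-monoˡ-true {false} {a'} h e rewrite e      = ∨-zeroʳ a'

∨-monoʳ-true : ∀ {a b b'} → (b ≡ true → b' ≡ true) → a ∨ b ≡ true → a ∨ b' ≡ true
∨-monoʳ-true {true}  h _ = refl
∨-monoʳ-true {false} h e = h e

∨-∧-weaken : ∀ a b c → a ∨ (b ∧ c) ≡ true → a ∨ c ≡ true
∨-∧-weaken true  _     _ _ = refl
∨-∧-weaken false true  _ e = e

∨-∧-regroup : ∀ a₁ a₂ b₁ b₂ c → (a₁ ∨ (b₁ ∧ c)) ∨ (a₂ ∨ (b₂ ∧ c)) ≡ (a₁ ∨ a₂) ∨ ((b₁ ∨ b₂) ∧ c)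
∨-∧-regroup = solve 5
  (λ a₁ a₂ b₁ b₂ c → (a₁ :+ (b₁ :* c)) :+ (a₂ :+ (b₂ :* c)) := (a₁ :+ a₂) :+ ((b₁ :+ b₂) :* c)) refl
  where open ∨-∧-Solver

-- Free variables under renaming and substitution

infix 4 _⊆fv_
_⊆fv_ : Tm → Tm → Set
N ⊆fv M = ∀ i → freeIn i N ≡ true → freeIn i M ≡ true

ext-injective : ∀ {ρ} → Injective _≡_ _≡_ ρ → Injective _≡_ _≡_ (ext ρ)
ext-injective inj {zero}  {zero}  e = refl
ext-injective inj {suc a} {suc b} e = cong suc (inj (suc-injective e))

freeIn-rename : ∀ {ρ} → Injective _≡_ _≡_ ρ → ∀ i M → freeIn (ρ i) (rename ρ M) ≡ freeIn i M
freeIn-rename inj i (var j)   = ≡ᵇ-injective inj i j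
freeIn-rename inj i (lam M)   = freeIn-rename (ext-injective inj) (suc i) M
freeIn-rename inj i (app M N) = cong₂ _∨_ (freeIn-rename inj i M) (freeIn-rename inj i N)

freeIn-rename-∉ : ∀ {ρ i} → (∀ j → ¬ ρ j ≡ i) → ∀ M → freeIn i (rename ρ M) ≡ false
freeIn-rename-∉ {ρ} {i} out (var j)   = ≡ᵇ-≢ (λ e → out j (sym e))
freeIn-rename-∉ {ρ} {i} out (lam M)   = freeIn-rename-∉ out' M
  where out' : ∀ j → ¬ ext ρ j ≡ suc i
        out' zero    ()
        out' (suc j) e = out j (suc-injective e)
freeIn-rename-∉ out (app M N) = cong₂ _∨_ (freeIn-rename-∉ out M) (freeIn-rename-∉ out N)

freeIn-weaken : ∀ i M → freeIn (suc i) (rename suc M) ≡ freeIn i M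
freeIn-weaken = freeIn-rename suc-injective

freeIn-weaken-0 : ∀ M → freeIn zero (rename suc M) ≡ false
freeIn-weaken-0 = freeIn-rename-∉ (λ _ ())

-- Substituting N for the variable k, seen under k binders (so M [ N ] = subst (substAt 0 N) M).
substAt : ℕ → Tm → ℕ → Tm
substAt zero    N = single N
substAt (suc k) N = exts (substAt k N)

-- The argument as it appears under the k binders: N weakened k times.
argAt : ℕ → Tm → Tm
argAt k N = substAt k N k

-- Variable i of a substitution instance comes from variable skipAt k i of M.
skipAt : ℕ → ℕ → ℕ
skipAt zero    i       = suc i
skipAt (suc k) zero    = zero
skipAt (suc k) (suc i) = suc (skipAt k i)

skipAt-≢ : ∀ k i → (skipAt k i ≡ᵇ k) ≡ false
skipAt-≢ zero    i       = refl
skipAt-≢ (suc k) zero    = refl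
skipAt-≢ (suc k) (suc i) = skipAt-≢ k i

substAt-other : ∀ N k j → ¬ j ≡ k →
  Σ[ j' ∈ ℕ ] substAt k N j ≡ var j' × (∀ i → (skipAt k i ≡ᵇ j) ≡ (i ≡ᵇ j'))
substAt-other N zero    zero    j≢k = ⊥-elim (j≢k refl)
substAt-other N zero    (suc j) j≢k = j , refl , λ i → refl
substAt-other N (suc k) zero    j≢k = zero , refl , λ { zero → refl ; (suc i) → refl }
substAt-other N (suc k) (suc j) j≢k with substAt-other N k j (λ e → j≢k (cong suc e))
... | j' , e , same = suc j' , cong (rename suc) e , λ { zero → refl ; (suc i) → same i }

freeIn-substAt : ∀ k N j i →
  freeIn i (substAt k N j) ≡ (skipAt k i ≡ᵇ j) ∨ ((k ≡ᵇ j) ∧ freeIn i (argAt k N))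
freeIn-substAt zero    N zero    i       = refl
freeIn-substAt zero    N (suc j) i       = sym (∨-identityʳ (i ≡ᵇ j))
freeIn-substAt (suc k) N zero    zero    = refl
freeIn-substAt (suc k) N zero    (suc i) = refl
freeIn-substAt (suc k) N (suc j) zero    =
  ≡-trans (freeIn-weaken-0 (substAt k N j))
    (sym (≡-trans (cong ((k ≡ᵇ j) ∧_) (freeIn-weaken-0 (argAt k N))) (∧-zeroʳ (k ≡ᵇ j))))
freeIn-substAt (suc k) N (suc j) (suc i) =
  ≡-trans (freeIn-weaken i (substAt k N j))
    (≡-trans (freeIn-substAt k N j i)
      (cong (λ b → (skipAt k i ≡ᵇ j) ∨ ((k ≡ᵇ j) ∧ b)) (sym (freeIn-weaken i (argAt k N)))))

freeIn-subst : ∀ k N M i →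
  freeIn i (subst (substAt k N) M) ≡ freeIn (skipAt k i) M ∨ (freeIn k M ∧ freeIn i (argAt k N))
freeIn-subst k N (var j)     i = freeIn-substAt k N j i
freeIn-subst k N (lam M)     i =
  ≡-trans (freeIn-subst (suc k) N M (suc i))
    (cong (λ b → freeIn (suc (skipAt k i)) M ∨ (freeIn (suc k) M ∧ b)) (freeIn-weaken i (argAt k N)))
freeIn-subst k N (app M₁ M₂) i
  rewrite freeIn-subst k N M₁ i | freeIn-subst k N M₂ i =
  ∨-∧-regroup (freeIn (skipAt k i) M₁) (freeIn (skipAt k i) M₂)
              (freeIn k M₁) (freeIn k M₂) (freeIn i (argAt k N))

▷β-fv : ∀ {M N} → M ▷β N → N ⊆fv M
▷β-fv (β {M} {N}) i e =
  ∨-∧-weaken (freeIn (suc i) M) (freeIn zero M) (freeIn i N) (≡-trans (sym (freeIn-subst 0 N M i)) e)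
▷β-fv (ξlam r)  i e = ▷β-fv r (suc i) e
▷β-fv (ξappL r) i e = ∨-monoˡ-true (▷β-fv r i) e
▷β-fv (ξappR r) i e = ∨-monoʳ-true (▷β-fv r i) e

-- Basic facts about typings

DomainIs : Env → Tm → Set
DomainIs Γ M = ∀ i → declared (Γ i) ≡ freeIn i M

domain : ∀ {M Γ U} → M ∶⟨ Γ ⊢ U ⟩ → DomainIs Γ M
domain (ax {x} {T})                        i = declared-declareIf ⌜ T ⌝ (i ≡ᵇ x)
domain (ω-i {M})                           i = declared-declareIf ω (freeIn i M)
domain (⇒-i D)                             i = domain D (suc i)
domain (⇒-i' D)                            i = domain D (suc i)
domain (⇒-e {Γ₁ = Γ₁} {Γ₂ = Γ₂} D₁ D₂) i =
  ≡-trans (declared-⊓ₘ (Γ₁ i) (Γ₂ i)) (cong₂ _∨_ (domain D₁ i) (domain D₂ i))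
domain (⊓-i D _)                           i = domain D i
domain (sub D _ p)                         i = ≡-trans (declared-≤ₘ (p i)) (domain D i)

conv : ∀ {M Γ Γ' U} → M ∶⟨ Γ ⊢ U ⟩ → Γ' ≗ Γ → M ∶⟨ Γ' ⊢ U ⟩
conv D e = sub D refl (≗⇒≤ₑ e)

-- Intersection introduction for typings in two environments (they share their domain).
⊓-intro : ∀ {M Γ₁ Γ₂ U₁ U₂} → M ∶⟨ Γ₁ ⊢ U₁ ⟩ → M ∶⟨ Γ₂ ⊢ U₂ ⟩ → M ∶⟨ Γ₁ ⊓ₑ Γ₂ ⊢ U₁ ⊓ U₂ ⟩
⊓-intro {Γ₁ = Γ₁} {Γ₂} D₁ D₂ =
  ⊓-i (sub D₁ refl (λ i → ⊓ₘ-lowerˡ (Γ₁ i) (Γ₂ i) (same i)))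
      (sub D₂ refl (λ i → ⊓ₘ-lowerʳ (Γ₁ i) (Γ₂ i) (same i)))
  where same : ∀ i → declared (Γ₁ i) ≡ declared (Γ₂ i)
        same i = ≡-trans (domain D₁ i) (sym (domain D₂ i))

⇒-i-ω : ∀ b {M Γ T} → M ∶⟨ declareIf ω b ∷ₑ Γ ⊢ ⌜ T ⌝ ⟩ → lam M ∶⟨ Γ ⊢ ⌜ ω ⇒ T ⌝ ⟩
⇒-i-ω true  = ⇒-i
⇒-i-ω false = ⇒-i'

var-typing : ∀ x U → var x ∶⟨ decl x U ⊢ U ⟩
var-typing x ω         = ω-i
var-typing x (U₁ ⊓ U₂) =
  ⊓-i (sub (var-typing x U₁) refl (λ i → declareIf-mono (i ≡ᵇ x) ⊓-l))
      (sub (var-typing x U₂) refl (λ i → declareIf-mono (i ≡ᵇ x) ⊓-r))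
var-typing x ⌜ T ⌝     = ax

var-lookup : ∀ {x Γ U} → var x ∶⟨ Γ ⊢ U ⟩ → Σ[ U' ∈ ITy ] Γ x ≡ just U' × U' ≤ U
var-lookup (ax {x})     = _ , cong (declareIf _) (≡ᵇ-refl x) , refl
var-lookup (ω-i {var x}) = _ , cong (declareIf ω) (≡ᵇ-refl x) , refl
var-lookup (⊓-i D₁ D₂) with var-lookup D₁ | var-lookup D₂
... | A , e₁ , A≤ | B , e₂ , B≤ with ≡-trans (sym e₁) e₂
...   | refl = A , e₁ , ⊓-glb A≤ B≤
var-lookup {x} (sub D le p) with var-lookup D
... | A , e , A≤ with ≤ₘ-just (≡-subst (_ ≤ₘ_) e (p x))
...   | B , e' , B≤ = B , e' , trans B≤ (trans A≤ le)

var-generation : ∀ {x Γ U} → var x ∶⟨ Γ ⊢ U ⟩ → Σ[ U' ∈ ITy ] Γ ≗ decl x U' × U' ≤ U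
var-generation {x} {Γ} D with var-lookup D
... | U' , Γx , le = U' , env , le
  where env : Γ ≗ decl x U'
        env i with i ≟ x
        ... | yes refl = ≡-trans Γx (cong (declareIf U') (sym (≡ᵇ-refl i)))
        ... | no i≢x   = ≡-trans (undeclared (≡-trans (domain D i) (≡ᵇ-≢ i≢x)))
                                 (cong (declareIf U') (sym (≡ᵇ-≢ i≢x)))

rename-inversion : ∀ {Q Γ U} → Q ∶⟨ Γ ⊢ U ⟩ → ∀ {ρ} P → Injective _≡_ _≡_ ρ →
  rename ρ P ≡ Q → P ∶⟨ (λ i → Γ (ρ i)) ⊢ U ⟩
rename-inversion (ax {T = T}) (var y) inj refl =
  sub ax refl (λ i → ≤ₘ-reflexive (cong (declareIf ⌜ T ⌝) (≡ᵇ-injective inj i y)))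
rename-inversion ω-i P inj refl =
  sub ω-i refl (λ i → ≤ₘ-reflexive (cong (declareIf ω) (freeIn-rename inj i P)))
rename-inversion (⇒-i D) (lam P) inj refl =
  ⇒-i (conv (rename-inversion D P (ext-injective inj) refl) λ { zero → refl ; (suc i) → refl })
rename-inversion (⇒-i' D) (lam P) inj refl =
  ⇒-i' (conv (rename-inversion D P (ext-injective inj) refl) λ { zero → refl ; (suc i) → refl })
rename-inversion (⇒-e D₁ D₂) (app P₁ P₂) inj refl =
  ⇒-e (rename-inversion D₁ P₁ inj refl) (rename-inversion D₂ P₂ inj refl)
rename-inversion (⊓-i D₁ D₂) P inj eq = ⊓-i (rename-inversion D₁ P inj eq) (rename-inversion D₂ P inj eq)
rename-inversion (sub D le p) {ρ} P inj eq = sub (rename-inversion D P inj eq) le (λ i → p (ρ i))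
rename-inversion ax (lam _) _ ()
rename-inversion ax (app _ _) _ ()
rename-inversion (⇒-i _) (var _) _ ()
rename-inversion (⇒-i _) (app _ _) _ ()
rename-inversion (⇒-i' _) (var _) _ ()
rename-inversion (⇒-i' _) (app _ _) _ ()
rename-inversion (⇒-e _ _) (var _) _ ()
rename-inversion (⇒-e _ _) (lam _) _ ()

-- The completion Γ↑M

complete : Maybe ITy → Bool → Maybe ITy
complete (just U) b = just U
complete nothing  b = declareIf ω b

↑-pointwise : ∀ Γ M i → (Γ ↑ M) i ≡ complete (Γ i) (freeIn i M)
↑-pointwise Γ M i with Γ i
... | just U  = refl
... | nothing = refl

complete-declared : ∀ m → complete m (declared m) ≡ m
complete-declared (just _) = refl
complete-declared nothing  = refl

↑-exact : ∀ {Γ M} → DomainIs Γ M → (Γ ↑ M) ≗ Γ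
↑-exact {Γ} {M} dom i =
  ≡-trans (↑-pointwise Γ M i)
    (≡-trans (cong (complete (Γ i)) (sym (dom i))) (complete-declared (Γ i)))

typed-↑ : ∀ {M Γ U} → M ∶⟨ Γ ⊢ U ⟩ → M ∶⟨ Γ ↑ M ⊢ U ⟩
typed-↑ D = conv D (↑-exact (domain D))

complete-mono : ∀ {a c} b → a ≤ₘ c → complete a b ≤ₘ complete c b
complete-mono b (just p) = just p
complete-mono b nothing  = ≤ₘ-refl

↑-mono : ∀ {Γ' Γ R} → Γ' ≤ₑ Γ → (Γ' ↑ R) ≤ₑ (Γ ↑ R)
↑-mono {Γ'} {Γ} {R} p i = begin
  (Γ' ↑ R) i                   ≡⟨ ↑-pointwise Γ' R i ⟩
  complete (Γ' i) (freeIn i R) ≲⟨ complete-mono (freeIn i R) (p i) ⟩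
  complete (Γ i) (freeIn i R)  ≡⟨ sym (↑-pointwise Γ R i) ⟩
  (Γ ↑ R) i                    ∎
  where open ≤ₘ-Reasoning

complete-ω : ∀ g b → (declared g ≡ true → b ≡ true) → complete g b ≤ₘ declareIf ω b
complete-ω (just _) true  _ = just ≤-ω
complete-ω (just _) false h with h refl
... | ()
complete-ω nothing  b     _ = ≤ₘ-refl

ω-expansion : ∀ {Q R Γ U} → Q ∶⟨ Γ ⊢ U ⟩ → Q ⊆fv R → R ∶⟨ Γ ↑ R ⊢ ω ⟩
ω-expansion {Q} {R} {Γ} D Q⊆R = sub ω-i refl λ i →
  ≤ₘ-trans (≤ₘ-reflexive (↑-pointwise Γ R i))
    (complete-ω (Γ i) (freeIn i R) (λ e → Q⊆R i (≡-trans (sym (domain D i)) e)))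

↑-lam : ∀ m Γ M → (complete m (freeIn zero M) ∷ₑ (Γ ↑ lam M)) ≗ ((m ∷ₑ Γ) ↑ M)
↑-lam m Γ M zero    = sym (↑-pointwise (m ∷ₑ Γ) M zero)
↑-lam m Γ M (suc i) = ≡-trans (↑-pointwise Γ (lam M) i) (sym (↑-pointwise (m ∷ₑ Γ) M (suc i)))

complete-⊓ˡ : ∀ g₁ g₂ b c → declared g₂ ≡ c → complete (g₁ ⊓ₘ g₂) (b ∨ c) ≤ₘ complete g₁ b ⊓ₘ g₂
complete-⊓ˡ (just _) (just _) b     c     _    = ≤ₘ-refl
complete-⊓ˡ (just _) nothing  b     c     _    = ≤ₘ-refl
complete-⊓ˡ nothing  (just _) true  c     _    = just ω-unit⁻¹
complete-⊓ˡ nothing  (just _) false c     _    = ≤ₘ-refl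
complete-⊓ˡ nothing  nothing  true  false refl = ≤ₘ-refl
complete-⊓ˡ nothing  nothing  false false refl = ≤ₘ-refl

complete-⊓ʳ : ∀ g₁ g₂ b c → declared g₁ ≡ b → complete (g₁ ⊓ₘ g₂) (b ∨ c) ≤ₘ g₁ ⊓ₘ complete g₂ c
complete-⊓ʳ (just _) (just _) b     c     _    = ≤ₘ-refl
complete-⊓ʳ (just _) nothing  b     true  _    = just (⊓-glb refl ≤-ω)
complete-⊓ʳ (just _) nothing  b     false _    = ≤ₘ-refl
complete-⊓ʳ nothing  g₂       false c     refl = ≤ₘ-refl

↑-appˡ : ∀ Γ₁ M {Γ₂ N} → DomainIs Γ₂ N → ((Γ₁ ⊓ₑ Γ₂) ↑ app M N) ≤ₑ ((Γ₁ ↑ M) ⊓ₑ Γ₂)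
↑-appˡ Γ₁ M {Γ₂} {N} dom i = begin
  ((Γ₁ ⊓ₑ Γ₂) ↑ app M N) i                            ≡⟨ ↑-pointwise (Γ₁ ⊓ₑ Γ₂) (app M N) i ⟩
  complete (Γ₁ i ⊓ₘ Γ₂ i) (freeIn i M ∨ freeIn i N)   ≲⟨ complete-⊓ˡ (Γ₁ i) (Γ₂ i) _ _ (dom i) ⟩
  complete (Γ₁ i) (freeIn i M) ⊓ₘ Γ₂ i                ≡⟨ cong (_⊓ₘ Γ₂ i) (sym (↑-pointwise Γ₁ M i)) ⟩
  (Γ₁ ↑ M) i ⊓ₘ Γ₂ i                                  ∎
  where open ≤ₘ-Reasoning

↑-appʳ : ∀ {Γ₁ M} Γ₂ N → DomainIs Γ₁ M → ((Γ₁ ⊓ₑ Γ₂) ↑ app M N) ≤ₑ (Γ₁ ⊓ₑ (Γ₂ ↑ N))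
↑-appʳ {Γ₁} {M} Γ₂ N dom i = begin
  ((Γ₁ ⊓ₑ Γ₂) ↑ app M N) i                            ≡⟨ ↑-pointwise (Γ₁ ⊓ₑ Γ₂) (app M N) i ⟩
  complete (Γ₁ i ⊓ₘ Γ₂ i) (freeIn i M ∨ freeIn i N)   ≲⟨ complete-⊓ʳ (Γ₁ i) (Γ₂ i) _ _ (dom i) ⟩
  Γ₁ i ⊓ₘ complete (Γ₂ i) (freeIn i N)                ≡⟨ cong (Γ₁ i ⊓ₘ_) (sym (↑-pointwise Γ₂ N i)) ⟩
  Γ₁ i ⊓ₘ (Γ₂ ↑ N) i                                  ∎
  where open ≤ₘ-Reasoning

-- Inversion of substitution

dropAt : ℕ → Env → Env
dropAt k Δ i = Δ (skipAt k i)

data ArgTyping (P : Tm) (m : Maybe ITy) : Env → Set where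
  unused : m ≡ nothing → ArgTyping P m ∅
  used   : ∀ {V Θ} → m ≡ just V → P ∶⟨ Θ ⊢ V ⟩ → ArgTyping P m Θ

record SubstInversion (N : Tm) (k : ℕ) (M : Tm) (Γ : Env) (U : ITy) : Set where
  constructor inverted
  field
    Δ    : Env
    Θ    : Env
    body : M ∶⟨ Δ ⊢ U ⟩
    arg  : ArgTyping (argAt k N) (Δ k) Θ
    env  : Γ ≤ₑ (dropAt k Δ ⊓ₑ Θ)

arg-merge : ∀ {P a b Θ₁ Θ₂} → ArgTyping P a Θ₁ → ArgTyping P b Θ₂ →
  Σ[ Θ ∈ Env ] ArgTyping P (a ⊓ₘ b) Θ × (Θ₁ ⊓ₑ Θ₂) ≤ₑ Θ
arg-merge (unused e₁) (unused e₂) = ∅ , unused (cong₂ _⊓ₘ_ e₁ e₂) , ≤ₑ-refl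
arg-merge {Θ₁ = Θ₁} (used e₁ d₁) (unused e₂) =
  Θ₁ , used (cong₂ _⊓ₘ_ e₁ e₂) d₁ , ≗⇒≤ₑ (λ i → ⊓ₘ-identityʳ (Θ₁ i))
arg-merge (unused e₁) (used e₂ d₂) = _ , used (cong₂ _⊓ₘ_ e₁ e₂) d₂ , ≤ₑ-refl
arg-merge (used e₁ d₁) (used e₂ d₂) = _ , used (cong₂ _⊓ₘ_ e₁ e₂) (⊓-intro d₁ d₂) , ≤ₑ-refl

arg-unweaken : ∀ {P m Θ} → ArgTyping (rename suc P) m Θ → ArgTyping P m (tail Θ) × Θ zero ≡ nothing
arg-unweaken (unused e) = unused e , refl
arg-unweaken {P} (used e d) =
  used e (rename-inversion d P suc-injective refl) ,
  undeclared (≡-trans (domain d zero) (freeIn-weaken-0 P))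

-- The substituted variable itself carries the whole typing of the argument;
-- any other variable is only renamed and carries no argument typing.
inversion-var : ∀ N k j {P Γ U} → P ∶⟨ Γ ⊢ U ⟩ → substAt k N j ≡ P → SubstInversion N k (var j) Γ U
inversion-var N k j {Γ = Γ} {U} D eq with j ≟ k
... | yes refl = inverted (decl k U) Γ (var-typing k U)
      (used (cong (declareIf U) (≡ᵇ-refl k)) (≡-subst (λ Q → Q ∶⟨ Γ ⊢ U ⟩) (sym eq) D))
      (λ i → ≤ₘ-reflexive (cong (λ b → declareIf U b ⊓ₘ Γ i) (sym (skipAt-≢ k i))))
... | no j≢k with substAt-other N k j j≢k
...   | j' , e , same with var-generation (≡-subst (λ Q → Q ∶⟨ Γ ⊢ U ⟩) (≡-trans (sym eq) e) D)
...     | U' , Γ≗ , le = inverted (decl j U') ∅ (sub (var-typing j U') le ≤ₑ-refl)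
          (unused (cong (declareIf U') (≡ᵇ-≢ (λ k≡j → j≢k (sym k≡j))))) (≗⇒≤ₑ env)
  where env : Γ ≗ (dropAt k (decl j U') ⊓ₑ ∅)
        env i = ≡-trans (Γ≗ i)
          (sym (≡-trans (⊓ₘ-identityʳ _) (cong (declareIf U') (same i))))

inversion-ω : ∀ N k M → SubstInversion N k M (envω (subst (substAt k N) M)) ω
inversion-ω N k M with freeIn k M in e
... | true  = inverted (envω M) (envω (argAt k N)) ω-i (used (cong (declareIf ω) e) ω-i) λ i → begin
  declareIf ω (freeIn i (subst (substAt k N) M))        ≡⟨ split i ⟩
  declareIf ω (freeIn (skipAt k i) M ∨ (true ∧ arg i))  ≲⟨ declareIf-∨ (freeIn (skipAt k i) M) (arg i) ⟩
  declareIf ω (freeIn (skipAt k i) M) ⊓ₘ declareIf ω (arg i) ∎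
  where
    open ≤ₘ-Reasoning
    arg : ℕ → Bool
    arg i = freeIn i (argAt k N)
    split : ∀ i → declareIf ω (freeIn i (subst (substAt k N) M))
                ≡ declareIf ω (freeIn (skipAt k i) M ∨ (true ∧ arg i))
    split i = cong (declareIf ω) (≡-trans (freeIn-subst k N M i)
                (cong (λ f → freeIn (skipAt k i) M ∨ (f ∧ arg i)) e))
... | false = inverted (envω M) ∅ ω-i (unused (cong (declareIf ω) e)) λ i → ≤ₘ-reflexive (begin
  declareIf ω (freeIn i (subst (substAt k N) M))  ≡⟨ split i ⟩
  declareIf ω (freeIn (skipAt k i) M)             ≡⟨ sym (⊓ₘ-identityʳ _) ⟩
  declareIf ω (freeIn (skipAt k i) M) ⊓ₘ nothing  ∎)
  where
    open ≡-Reasoning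
    split : ∀ i → declareIf ω (freeIn i (subst (substAt k N) M)) ≡ declareIf ω (freeIn (skipAt k i) M)
    split i = cong (declareIf ω) (≡-trans (freeIn-subst k N M i)
                (≡-trans (cong (λ f → freeIn (skipAt k i) M ∨ (f ∧ freeIn i (argAt k N))) e)
                  (∨-identityʳ (freeIn (skipAt k i) M))))

inversion-lam : ∀ {N k M m Γ U U'} → (∀ {Δ'} → M ∶⟨ m ∷ₑ Δ' ⊢ U ⟩ → lam M ∶⟨ Δ' ⊢ U' ⟩) →
  SubstInversion N (suc k) M (m ∷ₑ Γ) U → SubstInversion N k (lam M) Γ U'
inversion-lam {m = m} intro (inverted Δ Θ t a r) with arg-unweaken a
... | a' , Θ0 = inverted (tail Δ) (tail Θ) (intro (sub t refl binder)) a' (λ i → r (suc i))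
  where binder : (m ∷ₑ tail Δ) ≤ₑ Δ
        binder zero    = ≡-subst (m ≤ₘ_) (≡-trans (cong (Δ zero ⊓ₘ_) Θ0) (⊓ₘ-identityʳ (Δ zero))) (r zero)
        binder (suc i) = ≤ₘ-refl

inversion-merge : ∀ {N k M₁ M₂ M Γ₁ Γ₂ U₁ U₂ U} →
  (∀ {Δ₁ Δ₂} → M₁ ∶⟨ Δ₁ ⊢ U₁ ⟩ → M₂ ∶⟨ Δ₂ ⊢ U₂ ⟩ → M ∶⟨ Δ₁ ⊓ₑ Δ₂ ⊢ U ⟩) →
  SubstInversion N k M₁ Γ₁ U₁ → SubstInversion N k M₂ Γ₂ U₂ → SubstInversion N k M (Γ₁ ⊓ₑ Γ₂) U
inversion-merge {k = k} rule (inverted Δ₁ Θ₁ t₁ a₁ r₁) (inverted Δ₂ Θ₂ t₂ a₂ r₂)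
  with arg-merge a₁ a₂
... | Θ , a , Θ≤ = inverted (Δ₁ ⊓ₑ Δ₂) Θ (rule t₁ t₂) a λ i →
  ≤ₘ-trans (⊓ₘ-mono (r₁ i) (r₂ i))
    (≤ₘ-trans (⊓ₘ-interchange (dropAt k Δ₁ i) (Θ₁ i) (dropAt k Δ₂ i) (Θ₂ i))
      (⊓ₘ-monoʳ _ (Θ≤ i)))

subst-inversion : ∀ N {P Γ U} → P ∶⟨ Γ ⊢ U ⟩ → ∀ k M → subst (substAt k N) M ≡ P →
  SubstInversion N k M Γ U
subst-inversion N D k (var j) eq = inversion-var N k j D eq
subst-inversion N ω-i k (lam M) refl = inversion-ω N k (lam M)
subst-inversion N ω-i k (app M₁ M₂) refl = inversion-ω N k (app M₁ M₂)
subst-inversion N (⇒-i D) k (lam M) refl = inversion-lam ⇒-i (subst-inversion N D (suc k) M refl)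
subst-inversion N (⇒-i' D) k (lam M) refl = inversion-lam ⇒-i' (subst-inversion N D (suc k) M refl)
subst-inversion N (⇒-e D₁ D₂) k (app M₁ M₂) refl =
  inversion-merge ⇒-e (subst-inversion N D₁ k M₁ refl) (subst-inversion N D₂ k M₂ refl)
subst-inversion N (⊓-i D₁ D₂) k M eq with subst-inversion N D₁ k M eq | subst-inversion N D₂ k M eq
... | I₁ | I₂ with inversion-merge ⊓-intro I₁ I₂
...   | inverted Δ Θ t a r = inverted Δ Θ t a (≤ₑ-trans (λ i → ⊓ₘ-idem _) r)
subst-inversion N (sub D le p) k M eq with subst-inversion N D k M eq
... | inverted Δ Θ t a r = inverted Δ Θ (sub t le ≤ₑ-refl) a (≤ₑ-trans p r)

-- Expansion

Expands : Tm → Tm → Set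
Expands M N = ∀ {Γ U} → N ∶⟨ Γ ⊢ U ⟩ → M ∶⟨ Γ ↑ M ⊢ U ⟩

-- A β-redex expands to its contractum at strict types: invert the substitution, then
-- retype the redex; an erased argument (x ∉ dom Δ) is typed by ω over its free variables.
β-expansion-strict : ∀ {M N Γ T} → M [ N ] ∶⟨ Γ ⊢ ⌜ T ⌝ ⟩ →
  app (lam M) N ∶⟨ Γ ↑ app (lam M) N ⊢ ⌜ T ⌝ ⟩
β-expansion-strict {M} {N} {Γ} {T} D with subst-inversion N D 0 M refl
... | inverted Δ Θ t (used e d) r = typed-↑ (sub (⇒-e (⇒-i (conv t (∷ₑ-tail e))) d) refl r)
... | inverted Δ Θ t (unused e) r =
  sub (⇒-e F (ω-i {N})) refl (≤ₑ-trans (↑-mono {R = app (lam M) N} Γ≤Γ⊓∅) (↑-appʳ ∅ N (domain F)))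
  where
    F : lam M ∶⟨ Γ ⊢ ⌜ ω ⇒ T ⌝ ⟩
    F = sub (⇒-i' (conv t (∷ₑ-tail e))) refl (λ i → ≤ₘ-trans (r i) (≤ₘ-reflexive (⊓ₘ-identityʳ _)))
    Γ≤Γ⊓∅ : Γ ≤ₑ (Γ ⊓ₑ ∅)
    Γ≤Γ⊓∅ i = ≤ₘ-reflexive (sym (⊓ₘ-identityʳ (Γ i)))

β-expansion : ∀ {M N} → Expands (app (lam M) N) (M [ N ])
β-expansion {M} {N} {U = ω} D = ω-expansion D (▷β-fv (β {M} {N}))
β-expansion {U = U₁ ⊓ U₂} D = ⊓-i (β-expansion (sub D ⊓-l ≤ₑ-refl)) (β-expansion (sub D ⊓-r ≤ₑ-refl))
β-expansion {U = ⌜ T ⌝}   D = β-expansion-strict D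

lam-expansion : ∀ {M M'} → M' ⊆fv M → Expands M M' → Expands (lam M) (lam M')
lam-expansion {M' = M'} M'⊆M ih ω-i = ω-expansion (ω-i {lam M'}) (λ i → M'⊆M (suc i))
lam-expansion {M} ih⊆ ih (⇒-i {Γ = Γ} {U} D) = ⇒-i (conv (ih D) (↑-lam (just U) Γ M))
lam-expansion {M} ih⊆ ih (⇒-i' {Γ = Γ} D) = ⇒-i-ω (freeIn zero M) (conv (ih D) (↑-lam nothing Γ M))
lam-expansion M'⊆M ih (⊓-i D₁ D₂) = ⊓-i (lam-expansion M'⊆M ih D₁) (lam-expansion M'⊆M ih D₂)
lam-expansion M'⊆M ih (sub D le p) = sub (lam-expansion M'⊆M ih D) le (↑-mono p)

appˡ-expansion : ∀ {M M' N} → M' ⊆fv M → Expands M M' → Expands (app M N) (app M' N)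
appˡ-expansion {M' = M'} {N} M'⊆M ih ω-i = ω-expansion (ω-i {app M' N}) (λ i → ∨-monoˡ-true (M'⊆M i))
appˡ-expansion {M} M'⊆M ih (⇒-e {Γ₁ = Γ₁} D₁ D₂) = sub (⇒-e (ih D₁) D₂) refl (↑-appˡ Γ₁ M (domain D₂))
appˡ-expansion M'⊆M ih (⊓-i D₁ D₂) = ⊓-i (appˡ-expansion M'⊆M ih D₁) (appˡ-expansion M'⊆M ih D₂)
appˡ-expansion M'⊆M ih (sub D le p) = sub (appˡ-expansion M'⊆M ih D) le (↑-mono p)

appʳ-expansion : ∀ {M N N'} → N' ⊆fv N → Expands N N' → Expands (app M N) (app M N')
appʳ-expansion {M} {N' = N'} N'⊆N ih ω-i = ω-expansion (ω-i {app M N'}) (λ i → ∨-monoʳ-true (N'⊆N i))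
appʳ-expansion {N = N} N'⊆N ih (⇒-e {Γ₂ = Γ₂} D₁ D₂) = sub (⇒-e D₁ (ih D₂)) refl (↑-appʳ Γ₂ N (domain D₁))
appʳ-expansion N'⊆N ih (⊓-i D₁ D₂) = ⊓-i (appʳ-expansion N'⊆N ih D₁) (appʳ-expansion N'⊆N ih D₂)
appʳ-expansion N'⊆N ih (sub D le p) = sub (appʳ-expansion N'⊆N ih D) le (↑-mono p)

theorem3p11 : ∀ {M N : Tm} {Γ : Env} {U : ITy}
    → N ∶⟨ Γ ⊢ U ⟩ → M ▷β N → M ∶⟨ Γ ↑ M ⊢ U ⟩
theorem3p11 D β         = β-expansion D
theorem3p11 D (ξlam r)  = lam-expansion (▷β-fv r) (λ D' → theorem3p11 D' r) D
theorem3p11 D (ξappL r) = appˡ-expansion (▷β-fv r) (λ D' → theorem3p11 D' r) D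
theorem3p11 D (ξappR r) = appʳ-expansion (▷β-fv r) (λ D' → theorem3p11 D' r) D
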